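{- Let $a,d$ be coprime positive integers. Then for every natural number $x \le a$, the additive Collatz trajectory $O_{a,d}(x)$ loops.
   Context: For positive integers $a,d$, the additive Collatz function is $T_{a,d}(x) = x + a$ if $x \not\equiv 0 \pmod d$ and $T_{a,d}(x) = x/d$ if $x \equiv 0 \pmod d$. $T_{a,d}^{(k)}$ denotes the $k$-th iterate. The additive Collatz trajectory of $x$ is the infinite sequence $O_{a,d}(x) = (x, T_{a,d}(x), T_{a,d}^{(2)}(x), \dots)$. A sequence $(o_0,o_1,o_2,\dots)$ is said to loop if there exist positive integers $k, N$ such that $o_n = o_{n+k}$ for all $n > N$. -}

module Defs where

open import Data.Nat using (ℕ; zero; suc; _+_; _<_; NonZero)
open import Data.Nat.DivMod using (_/_)
open import Data.Nat.Divisibility using (_∣?_)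
open import Data.Product using (Σ; _×_)
open import Relation.Nullary using (yes; no)
open import Relation.Binary.PropositionalEquality using (_≡_)

T : (a d : ℕ) → .{{NonZero d}} → ℕ → ℕ
T a d x with d ∣? x
... | yes _ = x / d
... | no  _ = x + a

iterate : (f : ℕ → ℕ) → ℕ → ℕ → ℕ
iterate f zero    x = x
iterate f (suc k) x = f (iterate f k x)

O : (a d : ℕ) → .{{NonZero d}} → ℕ → (ℕ → ℕ)
O a d x n = iterate (T a d) n x

Loops : (ℕ → ℕ) → Set
Loops o = Σ ℕ λ k → Σ ℕ λ N → (0 < k) × (0 < N) × ((n : ℕ) → N < n → o n ≡ o (n + k))

-- Say y reaches a multiple if y + i a is a multiple of d not exceeding a d for some i.
-- As a is invertible modulo d, every y ≤ a reaches one with i < d. The property is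
-- preserved by T: adding a consumes one of the i steps (and i = 0 forces d ∣ y), while
-- dividing lands at y / d ≤ a. So the trajectory stays below a d, and a bounded orbit
-- repeats a value and is periodic from then on.
{-# OPTIONS --safe #-}
module Submission where

open import Defs
open import Data.Nat using (ℕ; _≤_; _<_; NonZero)
open import Data.Nat.Coprimality using (Coprime; coprime-Bézout)
open import Data.Nat.Base using (zero; suc; _+_; _*_; _∸_; z≤n; s≤s)
open import Data.Nat.GCD using (module Bézout)
open import Data.Nat.DivMod using (_/_; _%_; m≡m%n+[m/n]*n; m%n<n; m*n/n≡m; /-monoˡ-≤)
open import Data.Nat.Divisibility using (_∣_; divides; _∣?_; n∣m*n*o; ∣m+n∣m⇒∣n)
open import Data.Nat.Properties
open import Data.Nat.Tactic.RingSolver using (solve; solve-∀)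
open import Data.Fin.Base using (Fin; toℕ; fromℕ<)
open import Data.Fin.Properties using (pigeonhole; fromℕ<-injective)
open import Data.List.Base using ([]; _∷_)
open import Data.Product using (∃; _×_; _,_)
open import Relation.Nullary using (¬_; yes; no; contradiction)
open import Relation.Binary.PropositionalEquality

iterate-+ : ∀ (f : ℕ → ℕ) m n x → iterate f (m + n) x ≡ iterate f m (iterate f n x)
iterate-+ f zero    n x = refl
iterate-+ f (suc m) n x = cong f (iterate-+ f m n x)

repeat⇒Loops : ∀ (f : ℕ → ℕ) x i k → 0 < k →
               iterate f i x ≡ iterate f (i + k) x → Loops (λ n → iterate f n x)
repeat⇒Loops f x i k 0<k repeat = k , suc i , 0<k , s≤s z≤n , periodic
  where
  open ≡-Reasoning
  periodic : ∀ n → suc i < n → iterate f n x ≡ iterate f (n + k) x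
  periodic n 1+i<n = begin
    iterate f n x                               ≡⟨ cong (λ t → iterate f t x) (sym m+i≡n) ⟩
    iterate f (m + i) x                         ≡⟨ iterate-+ f m i x ⟩
    iterate f m (iterate f i x)                 ≡⟨ cong (iterate f m) repeat ⟩
    iterate f m (iterate f (i + k) x)           ≡⟨ iterate-+ f m (i + k) x ⟨
    iterate f (m + (i + k)) x                   ≡⟨ cong (λ t → iterate f t x) (+-assoc m i k) ⟨
    iterate f (m + i + k) x                     ≡⟨ cong (λ t → iterate f (t + k) x) m+i≡n ⟩
    iterate f (n + k) x                         ∎
    where
    m = n ∸ i
    m+i≡n : m + i ≡ n
    m+i≡n = m∸n+n≡m (≤-trans (n≤1+n i) (<⇒≤ 1+i<n))

bounded⇒Loops : ∀ (f : ℕ → ℕ) x B → (∀ n → iterate f n x ≤ B) → Loops (λ n → iterate f n x)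
bounded⇒Loops f x B bounded with pigeonhole (n<1+n (suc B)) orbit
  where
  orbit : Fin (suc (suc B)) → Fin (suc B)
  orbit n = fromℕ< (s≤s (bounded (toℕ n)))
... | i , j , i<j , same = repeat⇒Loops f x (toℕ i) (toℕ j ∸ toℕ i) (m<n⇒0<n∸m i<j)
  (begin
    iterate f (toℕ i) x                   ≡⟨ fromℕ<-injective _ _ _ _ same ⟩
    iterate f (toℕ j) x                   ≡⟨ cong (λ t → iterate f t x) (m+[n∸m]≡n (<⇒≤ i<j)) ⟨
    iterate f (toℕ i + (toℕ j ∸ toℕ i)) x ∎)
  where open ≡-Reasoning

-- Bézout gives x a ≡ ±1 (mod d); take i ≡ ∓ w x, i.e. i = w (d - 1) x or i = w x.
∃-offset-multiple : ∀ {a d} .{{_ : NonZero d}} → Coprime a d → ∀ w → ∃ λ i → d ∣ w + i * a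
∃-offset-multiple {a} {d@(suc e)} coprime w with coprime-Bézout coprime
... | Bézout.+- x y 1+yd≡xa = w * e * x , divides (w + w * e * y) (begin
  w + w * e * x * a         ≡⟨ cong (w +_) (*-assoc (w * e) x a) ⟩
  w + w * e * (x * a)       ≡⟨ cong (λ t → w + w * e * t) 1+yd≡xa ⟨
  w + w * e * (1 + y * d)   ≡⟨ solve (w ∷ e ∷ y ∷ []) ⟩
  (w + w * e * y) * d       ∎)
  where open ≡-Reasoning
... | Bézout.-+ x y 1+xa≡yd = w * x , divides (w * y) (begin
  w + w * x * a             ≡⟨ solve (w ∷ x ∷ a ∷ []) ⟩
  w * (1 + x * a)           ≡⟨ cong (w *_) 1+xa≡yd ⟩
  w * (y * d)               ≡⟨ *-assoc w y d ⟨
  w * y * d                 ∎)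
  where open ≡-Reasoning

offset-mod : ∀ {a d w} i .{{_ : NonZero d}} → d ∣ w + i * a → d ∣ w + i % d * a
offset-mod {a} {d} {w} i d∣w+ia = ∣m+n∣m⇒∣n (subst (d ∣_) split d∣w+ia) (n∣m*n*o (i / d) a)
  where
  open ≡-Reasoning
  rearrange : ∀ w r q d a → w + (r + q * d) * a ≡ q * d * a + (w + r * a)
  rearrange = solve-∀
  split : w + i * a ≡ i / d * d * a + (w + i % d * a)
  split = begin
    w + i * a                       ≡⟨ cong (λ t → w + t * a) (m≡m%n+[m/n]*n i d) ⟩
    w + (i % d + i / d * d) * a     ≡⟨ rearrange w (i % d) (i / d) d a ⟩
    i / d * d * a + (w + i % d * a) ∎

ReachesMultiple : ℕ → ℕ → ℕ → Set
ReachesMultiple a d y = ∃ λ i → d ∣ y + i * a × y + i * a ≤ a * d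

ReachesMultiple⇒≤ : ∀ {a d y} → ReachesMultiple a d y → y ≤ a * d
ReachesMultiple⇒≤ {y = y} (_ , _ , ≤ad) = ≤-trans (m≤m+n y _) ≤ad

≤⇒ReachesMultiple : ∀ {a d w} .{{_ : NonZero d}} → Coprime a d → w ≤ a → ReachesMultiple a d w
≤⇒ReachesMultiple {a} {d} {w} coprime w≤a with ∃-offset-multiple coprime w
... | i , d∣w+ia = i % d , offset-mod i d∣w+ia , (begin
  w + i % d * a       ≤⟨ +-monoˡ-≤ _ w≤a ⟩
  suc (i % d) * a     ≤⟨ *-monoˡ-≤ a (m%n<n i d) ⟩
  d * a               ≡⟨ *-comm d a ⟩
  a * d               ∎)
  where open ≤-Reasoning

ReachesMultiple-+ : ∀ {a d y} → ¬ d ∣ y → ReachesMultiple a d y → ReachesMultiple a d (y + a)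
ReachesMultiple-+ {y = y} d∤y (zero , d∣y+0 , _) = contradiction (subst (_ ∣_) (+-identityʳ y) d∣y+0) d∤y
ReachesMultiple-+ {a} {d} {y} _ (suc j , d∣y+ia , y+ia≤ad) =
  j , subst (d ∣_) regroup d∣y+ia , subst (_≤ a * d) regroup y+ia≤ad
  where
  regroup : y + suc j * a ≡ y + a + j * a
  regroup = sym (+-assoc y a (j * a))

ReachesMultiple-/ : ∀ {a d y} .{{_ : NonZero d}} → Coprime a d →
                    ReachesMultiple a d y → ReachesMultiple a d (y / d)
ReachesMultiple-/ {a} {d} {y} coprime reaches = ≤⇒ReachesMultiple coprime (begin
  y / d       ≤⟨ /-monoˡ-≤ d (ReachesMultiple⇒≤ reaches) ⟩
  a * d / d   ≡⟨ m*n/n≡m a d ⟩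
  a           ∎)
  where open ≤-Reasoning

T-preserves-ReachesMultiple : ∀ {a d y} .{{_ : NonZero d}} → Coprime a d →
                              ReachesMultiple a d y → ReachesMultiple a d (T a d y)
T-preserves-ReachesMultiple {d = d} {y} coprime reaches with d ∣? y
... | yes _   = ReachesMultiple-/ coprime reaches
... | no d∤y  = ReachesMultiple-+ d∤y reaches

O-ReachesMultiple : ∀ {a d x} .{{_ : NonZero d}} → Coprime a d → x ≤ a →
                    ∀ n → ReachesMultiple a d (O a d x n)
O-ReachesMultiple coprime x≤a zero    = ≤⇒ReachesMultiple coprime x≤a
O-ReachesMultiple coprime x≤a (suc n) = T-preserves-ReachesMultiple coprime (O-ReachesMultiple coprime x≤a n)

proposition3 : (a d : ℕ) → 0 < a → .{{_ : NonZero d}} → Coprime a d →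
    (x : ℕ) → x ≤ a → Loops (O a d x)
proposition3 a d _ coprime x x≤a =
  bounded⇒Loops (T a d) x (a * d) (λ n → ReachesMultiple⇒≤ (O-ReachesMultiple coprime x≤a n))
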